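{- As formal power series in $q$, $$\sum_{n=0}^{\infty}\sigma_d\mathrm{maex}(n)q^n=\sum_{k=1}^{\infty}k\,(-q;q)_{k-1}\sum_{m=1}^{\infty}q^{\frac{m(m+1)}{2}+km}.$$
   Context: For a nonempty partition $\pi$ with largest part $\ell(\pi)$, the maximal excludant $\mathrm{maex}(\pi)$ is the largest non-negative integer smaller than $\ell(\pi)$ that is not a part of $\pi$ (so it may be $0$); the empty partition is taken to contribute $0$. Let $\mathcal{D}(n)$ be the set of partitions of $n$ into distinct parts and $\sigma_d\mathrm{maex}(n):=\sum_{\pi\in\mathcal{D}(n)}\mathrm{maex}(\pi)$. Notation: $(a;q)_0=1$, $(a;q)_n=\prod_{j=0}^{n-1}(1-aq^j)$. -}

module Defs where

open import Data.Nat using (ℕ; zero; suc; _+_; _*_; _∸_; _⊔_; pred; _≟_; _≤ᵇ_)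
open import Data.Nat.Properties using ()
open import Data.Bool using (Bool; true; false; if_then_else_)
open import Data.List using (List; []; _∷_; map; upTo; foldr; filter; _++_)
open import Data.Nat.ListAction using (sum)
open import Data.List.Membership.DecPropositional _≟_ using (_∈?_)
open import Relation.Nullary.Decidable using (does; ⌊_⌋)

-- Partitions into
-- distinct parts of n are exactly the subsets of {1,…,n} whose elements
-- sum to n; we list every subset of {n, n-1, …, 1} (as a strictly
-- decreasing list) and keep those with sum n.

sublists : List ℕ → List (List ℕ)
sublists []       = [] ∷ []
sublists (x ∷ xs) = let r = sublists xs in map (x ∷_) r ++ r

downFrom1 : ℕ → List ℕ
downFrom1 zero    = []
downFrom1 (suc n) = suc n ∷ downFrom1 n

𝒟 : ℕ → List (List ℕ)
𝒟 n = filter (λ π → sum π ≟ n) (sublists (downFrom1 n))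

largest : List ℕ → ℕ
largest = foldr _⊔_ 0

-- maex(π): the largest non-negative integer smaller than ℓ(π) that is
-- not a part of π.  maexBelow π j = largest integer ≤ j not in π
-- (0 is never a part, so the search ends at 0 at the latest).
maexBelow : List ℕ → ℕ → ℕ
maexBelow π zero    = 0
maexBelow π (suc j) = if ⌊ suc j ∈? π ⌋ then maexBelow π j else suc j

maex : List ℕ → ℕ
maex π = maexBelow π (pred (largest π))
-- for the empty partition ℓ = 0 and maex = maexBelow [] 0 = 0

σdmaex : ℕ → ℕ
σdmaex n = sum (map maex (𝒟 n))

Series : Set
Series = ℕ → ℕ   -- n ↦ coefficient of q^n

Σ< : ℕ → (ℕ → ℕ) → ℕ
Σ< n f = sum (map f (upTo n))

_⊕_ : Series → Series → Series
(f ⊕ g) n = f n + g n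

_⊗_ : Series → Series → Series
(f ⊗ g) n = Σ< (suc n) (λ i → f i * g (n ∸ i))

one : Series
one zero    = 1
one (suc _) = 0

qpow : ℕ → Series
qpow e n = if ⌊ e ≟ n ⌋ then 1 else 0

_·_ : ℕ → Series → Series
(c · f) n = c * f n

-- (-q;q)_k = ∏_{j=0}^{k-1} (1 + q·q^j)
negqPoch : ℕ → Series
negqPoch zero    = one
negqPoch (suc k) = negqPoch k ⊗ (one ⊕ qpow (suc k))

-- Σ_{k=1}^{∞} F k, for a family with F k of q-order ≥ k (i.e. the
-- coefficient of q^n in F k vanishes for k > n); for such families
-- the coefficient of q^n of the infinite sum is the finite sum below.
Σ≥1 : (ℕ → Series) → Series
Σ≥1 F n = Σ< n (λ i → F (suc i) n)

-- For the families used below, F k has q-order ≥ k+1, so this truncation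
-- is exact.

triangle : ℕ → ℕ   -- m(m+1)/2
triangle zero    = 0
triangle (suc m) = triangle m + suc m

rhs : Series
rhs = Σ≥1 (λ k → k · (negqPoch (pred k) ⊗ Σ≥1 (λ m → qpow (triangle m + k * m))))

lhs : Series
lhs = σdmaex

{-# OPTIONS --safe #-}
module Submission where

-- Over the subsets π of {1,…,N}, each weighted by q to the sum of its parts, let C N,
-- M N and H N be the generating functions of 1, of maex π and of maex (N+1 ∷ π); so
-- C N = (-q;q)_N.  Splitting on whether N+1 ∈ π gives M (N+1) = M N + q^(N+1) H N and
-- H (N+1) = q^(N+1) H N + (N+1) C N: below a top part N+2, the part N+1 is skipped by
-- maex when present and is the maex when absent.  Unrolling, H N is the sum over i < N
-- of (i+1) q^((i+2)+…+N) C i, hence M N is the sum over i < j < N of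
-- (i+1) q^((i+2)+…+(j+1)) C i.  With k = i+1 and j = i+m the exponent is m(m+1)/2 + km,
-- and σ_d maex(n) is the coefficient of q^n in M n.

open import Defs
open import Data.Nat
open import Data.Nat.Properties
open import Algebra.Properties.CommutativeSemigroup +-commutativeSemigroup using (interchange)
open import Data.Bool using (true; false; if_then_else_)
open import Data.Empty using (⊥-elim)
open import Data.List using (List; []; _∷_; map; upTo; filter; _++_; [_])
open import Data.List.Membership.DecPropositional _≟_ using (_∈?_)
open import Data.List.Membership.Propositional using (_∈_)
open import Data.List.Properties using (map-++; map-cong; map-cong-local; upTo-∷ʳ)
open import Data.List.Relation.Unary.All as All using (All; []; _∷_)
open import Data.List.Relation.Unary.All.Properties using (++⁺; map⁺; applyUpTo⁺₁)
open import Data.List.Relation.Unary.Any using (here; there)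
open import Data.Nat.ListAction using (sum)
open import Data.Nat.ListAction.Properties using (sum-++)
open import Data.Nat.Tactic.RingSolver using (solve-∀)
open import Data.Sum using (inj₁; inj₂)
open import Function using (id; _∘_; case_of_)
open import Relation.Binary.PropositionalEquality hiding ([_])
open import Relation.Nullary using (¬_; yes; no)
open ≡-Reasoning

sum-map-0 : ∀ {A : Set} (xs : List A) → sum (map (λ _ → 0) xs) ≡ 0
sum-map-0 []       = refl
sum-map-0 (_ ∷ xs) = sum-map-0 xs

sum-map-+ : ∀ {A : Set} (f g : A → ℕ) xs →
            sum (map (λ x → f x + g x) xs) ≡ sum (map f xs) + sum (map g xs)
sum-map-+ f g []       = refl
sum-map-+ f g (x ∷ xs) = begin
  f x + g x + sum (map (λ x → f x + g x) xs)    ≡⟨ cong (f x + g x +_) (sum-map-+ f g xs) ⟩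
  f x + g x + (sum (map f xs) + sum (map g xs))  ≡⟨ interchange (f x) (g x) _ _ ⟩
  f x + sum (map f xs) + (g x + sum (map g xs))  ∎

sum-map-*ˡ : ∀ {A : Set} c (f : A → ℕ) xs → c * sum (map f xs) ≡ sum (map (λ x → c * f x) xs)
sum-map-*ˡ c f []       = *-zeroʳ c
sum-map-*ˡ c f (x ∷ xs) = trans (*-distribˡ-+ c (f x) _) (cong (c * f x +_) (sum-map-*ˡ c f xs))

sum-map-swap : ∀ {A B : Set} (f : A → B → ℕ) xs ys →
               sum (map (λ x → sum (map (f x) ys)) xs) ≡ sum (map (λ y → sum (map (λ x → f x y) xs)) ys)
sum-map-swap f []       ys = sym (sum-map-0 ys)
sum-map-swap f (x ∷ xs) ys =
  trans (cong (sum (map (f x) ys) +_) (sum-map-swap f xs ys)) (sym (sum-map-+ (f x) _ ys))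

Σ<-suc : ∀ n f → Σ< (suc n) f ≡ Σ< n f + f n
Σ<-suc n f = begin
  sum (map f (upTo (suc n)))       ≡⟨ cong (sum ∘ map f) (upTo-∷ʳ n) ⟨
  sum (map f (upTo n ++ [ n ]))    ≡⟨ cong sum (map-++ f (upTo n) [ n ]) ⟩
  sum (map f (upTo n) ++ [ f n ])  ≡⟨ sum-++ (map f (upTo n)) [ f n ] ⟩
  Σ< n f + (f n + 0)               ≡⟨ cong (Σ< n f +_) (+-identityʳ (f n)) ⟩
  Σ< n f + f n                     ∎

Σ<-cong : ∀ n {f g} → (∀ {i} → i < n → f i ≡ g i) → Σ< n f ≡ Σ< n g
Σ<-cong n f≗g = cong sum (map-cong-local (applyUpTo⁺₁ id n f≗g))

Σ<-zero : ∀ n {f} → (∀ {i} → i < n → f i ≡ 0) → Σ< n f ≡ 0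
Σ<-zero n f≗0 = trans (Σ<-cong n f≗0) (sum-map-0 (upTo n))

Σ<-extend : ∀ {a b} f → a ≤ b → (∀ {i} → a ≤ i → f i ≡ 0) → Σ< a f ≡ Σ< b f
Σ<-extend {a} f a≤b f≗0 = extend (≤⇒≤′ a≤b)
  where
    extend : ∀ {b} → a ≤′ b → Σ< a f ≡ Σ< b f
    extend ≤′-refl = refl
    extend {suc b} (≤′-step a≤′b) = begin
      Σ< a f        ≡⟨ extend a≤′b ⟩
      Σ< b f        ≡⟨ +-identityʳ _ ⟨
      Σ< b f + 0    ≡⟨ cong (Σ< b f +_) (f≗0 (≤′⇒≤ a≤′b)) ⟨
      Σ< b f + f b  ≡⟨ Σ<-suc b f ⟨
      Σ< (suc b) f  ∎

Σ<-delta : ∀ N {c} g → c < N → (∀ {a} → a < N → a ≢ c → g a ≡ 0) → Σ< N g ≡ g c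
Σ<-delta (suc N) {c} g c<1+N g≗0 with m≤n⇒m<n∨m≡n (s≤s⁻¹ c<1+N)
... | inj₁ c<N = begin
  Σ< (suc N) g  ≡⟨ Σ<-suc N g ⟩
  Σ< N g + g N  ≡⟨ cong₂ _+_ (Σ<-delta N g c<N (g≗0 ∘ m<n⇒m<1+n)) (g≗0 ≤-refl (≢-sym (<⇒≢ c<N))) ⟩
  g c + 0       ≡⟨ +-identityʳ _ ⟩
  g c           ∎
... | inj₂ refl = begin
  Σ< (suc N) g  ≡⟨ Σ<-suc N g ⟩
  Σ< N g + g N  ≡⟨ cong (_+ g N) (Σ<-zero N (λ a<N → g≗0 (m<n⇒m<1+n a<N) (<⇒≢ a<N))) ⟩
  g N           ∎

Σ<-triangle : ∀ n (T : ℕ → ℕ → ℕ) →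
              Σ< n (λ j → Σ< j (λ i → T i j)) ≡ Σ< n (λ i → Σ< (n ∸ suc i) (λ m → T i (suc i + m)))
Σ<-triangle zero    T = refl
Σ<-triangle (suc n) T = begin
  Σ< (suc n) (λ j → Σ< j (λ i → T i j))
    ≡⟨ Σ<-suc n _ ⟩
  Σ< n (λ j → Σ< j (λ i → T i j)) + Σ< n (λ i → T i n)
    ≡⟨ cong (_+ Σ< n (λ i → T i n)) (Σ<-triangle n T) ⟩
  Σ< n (λ i → Σ< (n ∸ suc i) (row i)) + Σ< n (λ i → T i n)
    ≡⟨ sum-map-+ (λ i → Σ< (n ∸ suc i) (row i)) (λ i → T i n) (upTo n) ⟨
  Σ< n (λ i → Σ< (n ∸ suc i) (row i) + T i n)
    ≡⟨ Σ<-cong n grow ⟩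
  Σ< n (λ i → Σ< (n ∸ i) (row i))
    ≡⟨ +-identityʳ _ ⟨
  Σ< n (λ i → Σ< (n ∸ i) (row i)) + Σ< 0 (row n)
    ≡⟨ cong (λ k → Σ< n (λ i → Σ< (n ∸ i) (row i)) + Σ< k (row n)) (n∸n≡0 n) ⟨
  Σ< n (λ i → Σ< (n ∸ i) (row i)) + Σ< (n ∸ n) (row n)
    ≡⟨ Σ<-suc n (λ i → Σ< (suc n ∸ suc i) (row i)) ⟨
  Σ< (suc n) (λ i → Σ< (suc n ∸ suc i) (row i))
    ∎
  where
    row : ℕ → ℕ → ℕ
    row i m = T i (suc i + m)
    grow : ∀ {i} → i < n → Σ< (n ∸ suc i) (row i) + T i n ≡ Σ< (n ∸ i) (row i)
    grow {i} i<n = begin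
      Σ< (n ∸ suc i) (row i) + T i n                     ≡⟨ cong (λ j → Σ< (n ∸ suc i) (row i) + T i j) (m+[n∸m]≡n i<n) ⟨
      Σ< (n ∸ suc i) (row i) + row i (n ∸ suc i)         ≡⟨ Σ<-suc (n ∸ suc i) (row i) ⟨
      Σ< (suc (n ∸ suc i)) (row i)                       ≡⟨ cong (λ k → Σ< k (row i)) (+-∸-assoc 1 i<n) ⟨
      Σ< (n ∸ i) (row i)                                 ∎

shift : ℕ → Series → Series
shift zero    f n       = f n
shift (suc e) f zero    = 0
shift (suc e) f (suc n) = shift e f n

shift-≤ : ∀ {e n} f → e ≤ n → shift e f n ≡ f (n ∸ e)
shift-≤ {zero}          f z≤n       = refl
shift-≤ {suc e} {suc n} f (s≤s e≤n) = shift-≤ f e≤n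

shift-> : ∀ {e n} f → n < e → shift e f n ≡ 0
shift-> {suc e} {zero}  f n<e       = refl
shift-> {suc e} {suc n} f (s≤s n<e) = shift-> f n<e

shift-0 : ∀ e n → shift e (λ _ → 0) n ≡ 0
shift-0 zero    n       = refl
shift-0 (suc e) zero    = refl
shift-0 (suc e) (suc n) = shift-0 e n

shift-cong : ∀ e {f g} → (∀ m → f m ≡ g m) → ∀ n → shift e f n ≡ shift e g n
shift-cong zero    f≗g n       = f≗g n
shift-cong (suc e) f≗g zero    = refl
shift-cong (suc e) f≗g (suc n) = shift-cong e f≗g n

shift-+ : ∀ e f g n → shift e (λ m → f m + g m) n ≡ shift e f n + shift e g n
shift-+ zero    f g n       = refl
shift-+ (suc e) f g zero    = refl
shift-+ (suc e) f g (suc n) = shift-+ e f g n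

shift-*ˡ : ∀ e c f n → shift e (λ m → c * f m) n ≡ c * shift e f n
shift-*ˡ zero    c f n       = refl
shift-*ˡ (suc e) c f zero    = sym (*-zeroʳ c)
shift-*ˡ (suc e) c f (suc n) = shift-*ˡ e c f n

shift-Σ< : ∀ e k (h : ℕ → Series) n → shift e (λ m → Σ< k (λ i → h i m)) n ≡ Σ< k (λ i → shift e (h i) n)
shift-Σ< zero    k h n       = refl
shift-Σ< (suc e) k h zero    = sym (sum-map-0 (upTo k))
shift-Σ< (suc e) k h (suc n) = shift-Σ< e k h n

shift-shift : ∀ a b f n → shift a (shift b f) n ≡ shift (a + b) f n
shift-shift zero    b f n       = refl
shift-shift (suc a) b f zero    = refl
shift-shift (suc a) b f (suc n) = shift-shift a b f n

qpow-≢ : ∀ {e x} → e ≢ x → qpow e x ≡ 0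
qpow-≢ {e} {x} e≢x with e ≟ x
... | yes e≡x = ⊥-elim (e≢x e≡x)
... | no _    = refl

qpow-diag : ∀ e → qpow e e ≡ 1
qpow-diag e with e ≟ e
... | yes _   = refl
... | no e≢e  = ⊥-elim (e≢e refl)

⊗-qpow : ∀ f e n → (f ⊗ qpow e) n ≡ shift e f n
⊗-qpow f e n with e ≤? n
... | no e≰n = trans (Σ<-zero (suc n) vanish) (sym (shift-> f (≰⇒> e≰n)))
  where
    vanish : ∀ {a} → a < suc n → f a * qpow e (n ∸ a) ≡ 0
    vanish {a} _ = trans (cong (f a *_) (qpow-≢ λ e≡ → e≰n (subst (_≤ n) (sym e≡) (m∸n≤m n a)))) (*-zeroʳ (f a))
... | yes e≤n = begin
  (f ⊗ qpow e) n                    ≡⟨ Σ<-delta (suc n) _ (s≤s (m∸n≤m n e)) vanish ⟩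
  f (n ∸ e) * qpow e (n ∸ (n ∸ e))  ≡⟨ cong (λ x → f (n ∸ e) * qpow e x) (m∸[m∸n]≡n e≤n) ⟩
  f (n ∸ e) * qpow e e              ≡⟨ cong (f (n ∸ e) *_) (qpow-diag e) ⟩
  f (n ∸ e) * 1                     ≡⟨ *-identityʳ _ ⟩
  f (n ∸ e)                         ≡⟨ shift-≤ f e≤n ⟨
  shift e f n                       ∎
  where
    vanish : ∀ {a} → a < suc n → a ≢ n ∸ e → f a * qpow e (n ∸ a) ≡ 0
    vanish {a} a<1+n a≢ = trans (cong (f a *_) (qpow-≢ e≢)) (*-zeroʳ (f a))
      where
        e≢ : e ≢ n ∸ a
        e≢ e≡ = a≢ (trans (sym (m∸[m∸n]≡n (s≤s⁻¹ a<1+n))) (cong (n ∸_) (sym e≡)))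

⊗-one : ∀ f n → (f ⊗ one) n ≡ f n
⊗-one f n = trans (Σ<-cong (suc n) (λ {a} _ → cong (f a *_) (one≡qpow0 (n ∸ a)))) (⊗-qpow f 0 n)
  where
    one≡qpow0 : ∀ m → one m ≡ qpow 0 m
    one≡qpow0 zero    = refl
    one≡qpow0 (suc m) = refl

⊗-distribˡ-⊕ : ∀ f g h n → (f ⊗ (g ⊕ h)) n ≡ (f ⊗ g) n + (f ⊗ h) n
⊗-distribˡ-⊕ f g h n =
  trans (Σ<-cong (suc n) (λ {a} _ → *-distribˡ-+ (f a) (g (n ∸ a)) (h (n ∸ a))))
        (sum-map-+ (λ a → f a * g (n ∸ a)) (λ a → f a * h (n ∸ a)) (upTo (suc n)))

negqPoch-suc : ∀ N n → negqPoch (suc N) n ≡ shift (suc N) (negqPoch N) n + negqPoch N n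
negqPoch-suc N n = begin
  (negqPoch N ⊗ (one ⊕ qpow (suc N))) n                 ≡⟨ ⊗-distribˡ-⊕ (negqPoch N) one (qpow (suc N)) n ⟩
  (negqPoch N ⊗ one) n + (negqPoch N ⊗ qpow (suc N)) n  ≡⟨ cong₂ _+_ (⊗-one (negqPoch N) n) (⊗-qpow (negqPoch N) (suc N) n) ⟩
  negqPoch N n + shift (suc N) (negqPoch N) n           ≡⟨ +-comm (negqPoch N n) _ ⟩
  shift (suc N) (negqPoch N) n + negqPoch N n           ∎

⊗-Σ≥1-qpow : ∀ f (e : ℕ → ℕ) → (∀ m → m ≤ e m) → ∀ n →
             (f ⊗ Σ≥1 (qpow ∘ e)) n ≡ Σ< n (λ m → shift (e (suc m)) f n)
⊗-Σ≥1-qpow f e m≤e n = begin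
  Σ< (suc n) (λ a → f a * Σ< (n ∸ a) (λ m → qpow (e (suc m)) (n ∸ a)))
    ≡⟨ Σ<-cong (suc n) (λ {a} _ → cong (f a *_) (Σ<-extend _ (m∸n≤m n a) (λ {m} → vanish a m))) ⟩
  Σ< (suc n) (λ a → f a * Σ< n (λ m → qpow (e (suc m)) (n ∸ a)))
    ≡⟨ Σ<-cong (suc n) (λ {a} _ → sum-map-*ˡ (f a) _ (upTo n)) ⟩
  Σ< (suc n) (λ a → Σ< n (λ m → f a * qpow (e (suc m)) (n ∸ a)))
    ≡⟨ sum-map-swap (λ a m → f a * qpow (e (suc m)) (n ∸ a)) (upTo (suc n)) (upTo n) ⟩
  Σ< n (λ m → (f ⊗ qpow (e (suc m))) n)
    ≡⟨ Σ<-cong n (λ {m} _ → ⊗-qpow f (e (suc m)) n) ⟩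
  Σ< n (λ m → shift (e (suc m)) f n)
    ∎
  where
    vanish : ∀ a m → n ∸ a ≤ m → qpow (e (suc m)) (n ∸ a) ≡ 0
    vanish a m n∸a≤m = qpow-≢ λ e≡ → <⇒≱ (s≤s n∸a≤m) (subst (suc m ≤_) e≡ (m≤e (suc m)))

maexBelow-∈ : ∀ {π j} → suc j ∈ π → maexBelow π (suc j) ≡ maexBelow π j
maexBelow-∈ {π} {j} 1+j∈π with suc j ∈? π
... | yes _     = refl
... | no 1+j∉π  = ⊥-elim (1+j∉π 1+j∈π)

maexBelow-∉ : ∀ {π j} → ¬ suc j ∈ π → maexBelow π (suc j) ≡ suc j
maexBelow-∉ {π} {j} 1+j∉π with suc j ∈? π
... | yes 1+j∈π = ⊥-elim (1+j∉π 1+j∈π)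
... | no _      = refl

maexBelow-∷-above : ∀ {x π} j → j < x → maexBelow (x ∷ π) j ≡ maexBelow π j
maexBelow-∷-above         zero    _   = refl
maexBelow-∷-above {x} {π} (suc j) j<x = case suc j ∈? π of λ where
  (yes 1+j∈π) → begin
    maexBelow (x ∷ π) (suc j)  ≡⟨ maexBelow-∈ (there 1+j∈π) ⟩
    maexBelow (x ∷ π) j        ≡⟨ maexBelow-∷-above j (<-trans (n<1+n j) j<x) ⟩
    maexBelow π j              ≡⟨ maexBelow-∈ 1+j∈π ⟨
    maexBelow π (suc j)        ∎
  (no 1+j∉π) → begin
    maexBelow (x ∷ π) (suc j)  ≡⟨ maexBelow-∉ (λ { (here 1+j≡x) → <⇒≢ j<x 1+j≡x ; (there 1+j∈π) → 1+j∉π 1+j∈π }) ⟩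
    suc j                      ≡⟨ maexBelow-∉ 1+j∉π ⟨
    maexBelow π (suc j)        ∎

∈⇒≤largest : ∀ {x π} → x ∈ π → x ≤ largest π
∈⇒≤largest {π = y ∷ π} (here refl) = m≤m⊔n y (largest π)
∈⇒≤largest {π = y ∷ π} (there x∈π) = ≤-trans (∈⇒≤largest x∈π) (m≤n⊔m y (largest π))

maex-∷-top : ∀ {a π} → largest π ≤ a → maex (a ∷ π) ≡ maexBelow (a ∷ π) (pred a)
maex-∷-top {a} {π} π≤a = cong (maexBelow (a ∷ π) ∘ pred) (m≥n⇒m⊔n≡m π≤a)

maex-∷-∷ : ∀ {N} π → largest π ≤ N → maex (suc (suc N) ∷ suc N ∷ π) ≡ maex (suc N ∷ π)
maex-∷-∷ {N} π π≤N = begin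
  maex (suc (suc N) ∷ suc N ∷ π)               ≡⟨ maex-∷-top (⊔-lub (n≤1+n (suc N)) (m≤n⇒m≤1+n (m≤n⇒m≤1+n π≤N))) ⟩
  maexBelow (suc (suc N) ∷ suc N ∷ π) (suc N)  ≡⟨ maexBelow-∷-above (suc N) ≤-refl ⟩
  maexBelow (suc N ∷ π) (suc N)                ≡⟨ maexBelow-∈ {j = N} (here refl) ⟩
  maexBelow (suc N ∷ π) N                      ≡⟨ maex-∷-top (m≤n⇒m≤1+n π≤N) ⟨
  maex (suc N ∷ π)                             ∎

maex-∷-gap : ∀ {N} π → largest π ≤ N → maex (suc (suc N) ∷ π) ≡ suc N
maex-∷-gap {N} π π≤N = begin
  maex (suc (suc N) ∷ π)               ≡⟨ maex-∷-top (m≤n⇒m≤1+n (m≤n⇒m≤1+n π≤N)) ⟩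
  maexBelow (suc (suc N) ∷ π) (suc N)  ≡⟨ maexBelow-∷-above (suc N) ≤-refl ⟩
  maexBelow π (suc N)                  ≡⟨ maexBelow-∉ (λ 1+N∈π → <⇒≱ (s≤s π≤N) (∈⇒≤largest 1+N∈π)) ⟩
  suc N                                ∎

subsets : ℕ → List (List ℕ)
subsets N = sublists (downFrom1 N)

largest-subsets : ∀ N → All (λ π → largest π ≤ N) (subsets N)
largest-subsets zero    = z≤n ∷ []
largest-subsets (suc N) =
  ++⁺ (map⁺ (All.map (⊔-lub ≤-refl ∘ m≤n⇒m≤1+n) (largest-subsets N)))
      (All.map m≤n⇒m≤1+n (largest-subsets N))

-- The indicator is written with _≡ᵇ_ rather than ⌊ _≟_ ⌋: it is what filter (λ π → sum π ≟ n)
-- actually tests, and it reduces on suc m ≡ᵇ suc n.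
gf : List (List ℕ) → (List ℕ → ℕ) → Series
gf πs v n = sum (map (λ π → if sum π ≡ᵇ n then v π else 0) πs)

sum-map-filter : ∀ v n πs → sum (map v (filter (λ π → sum π ≟ n) πs)) ≡ gf πs v n
sum-map-filter v n []       = refl
sum-map-filter v n (π ∷ πs) with sum π ≡ᵇ n
... | true  = cong (v π +_) (sum-map-filter v n πs)
... | false = sum-map-filter v n πs

gf-++ : ∀ πs ρs v n → gf (πs ++ ρs) v n ≡ gf πs v n + gf ρs v n
gf-++ πs ρs v n = trans (cong sum (map-++ _ πs ρs)) (sum-++ (map _ πs) _)

if-≡ᵇ-+ : ∀ x s (a : ℕ) n → (if x + s ≡ᵇ n then a else 0) ≡ shift x (λ m → if s ≡ᵇ m then a else 0) n
if-≡ᵇ-+ zero    s a n       = refl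
if-≡ᵇ-+ (suc x) s a zero    = refl
if-≡ᵇ-+ (suc x) s a (suc n) = if-≡ᵇ-+ x s a n

gf-map-∷ : ∀ x πs v n → gf (map (x ∷_) πs) v n ≡ shift x (gf πs (v ∘ (x ∷_))) n
gf-map-∷ x []       v n = sym (shift-0 x n)
gf-map-∷ x (π ∷ πs) v n = begin
  (if x + sum π ≡ᵇ n then v (x ∷ π) else 0) + gf (map (x ∷_) πs) v n
    ≡⟨ cong₂ _+_ (if-≡ᵇ-+ x (sum π) (v (x ∷ π)) n) (gf-map-∷ x πs v n) ⟩
  shift x (λ m → if sum π ≡ᵇ m then v (x ∷ π) else 0) n + shift x (gf πs (v ∘ (x ∷_))) n
    ≡⟨ shift-+ x _ _ n ⟨
  shift x (gf (π ∷ πs) (v ∘ (x ∷_))) n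
    ∎

gf-cong : ∀ {P : List ℕ → Set} {πs} v w n → All P πs → (∀ π → P π → v π ≡ w π) → gf πs v n ≡ gf πs w n
gf-cong v w n Pπs v≗w =
  cong sum (map-cong-local (All.map (λ {π} Pπ → cong (λ z → if sum π ≡ᵇ n then z else 0) (v≗w π Pπ)) Pπs))

gf-const : ∀ πs c n → gf πs (λ _ → c) n ≡ c * gf πs (λ _ → 1) n
gf-const πs c n = trans (cong sum (map-cong (λ π → if-scale (sum π ≡ᵇ n)) πs))
                        (sym (sum-map-*ˡ c _ πs))
  where
    if-scale : ∀ b → (if b then c else 0) ≡ c * (if b then 1 else 0)
    if-scale true  = sym (*-identityʳ c)
    if-scale false = sym (*-zeroʳ c)

gf-subsets-suc : ∀ N v n → gf (subsets (suc N)) v n ≡ shift (suc N) (gf (subsets N) (v ∘ (suc N ∷_))) n + gf (subsets N) v n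
gf-subsets-suc N v n = trans (gf-++ (map (suc N ∷_) (subsets N)) (subsets N) v n)
                             (cong (_+ gf (subsets N) v n) (gf-map-∷ (suc N) (subsets N) v n))

subsetGF : ℕ → Series
subsetGF N = gf (subsets N) (λ _ → 1)

maexGF : ℕ → Series
maexGF N = gf (subsets N) maex

toppedMaexGF : ℕ → Series
toppedMaexGF N = gf (subsets N) (maex ∘ (suc N ∷_))

subsetGF≡negqPoch : ∀ N n → subsetGF N n ≡ negqPoch N n
subsetGF≡negqPoch zero    zero    = refl
subsetGF≡negqPoch zero    (suc n) = refl
subsetGF≡negqPoch (suc N) n       = begin
  subsetGF (suc N) n                           ≡⟨ gf-subsets-suc N _ n ⟩
  shift (suc N) (subsetGF N) n + subsetGF N n  ≡⟨ cong₂ _+_ (shift-cong (suc N) (subsetGF≡negqPoch N) n) (subsetGF≡negqPoch N n) ⟩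
  shift (suc N) (negqPoch N) n + negqPoch N n  ≡⟨ negqPoch-suc N n ⟨
  negqPoch (suc N) n                           ∎

maexGF-unrolled : ∀ N n → maexGF N n ≡ Σ< N (λ j → shift (suc j) (toppedMaexGF j) n)
maexGF-unrolled zero    zero    = refl
maexGF-unrolled zero    (suc n) = refl
maexGF-unrolled (suc N) n       = begin
  maexGF (suc N) n                                              ≡⟨ gf-subsets-suc N maex n ⟩
  shift (suc N) (toppedMaexGF N) n + maexGF N n                 ≡⟨ +-comm _ (maexGF N n) ⟩
  maexGF N n + shift (suc N) (toppedMaexGF N) n                 ≡⟨ cong (_+ shift (suc N) (toppedMaexGF N) n) (maexGF-unrolled N n) ⟩
  Σ< N (λ j → shift (suc j) (toppedMaexGF j) n) + shift (suc N) (toppedMaexGF N) n  ≡⟨ Σ<-suc N (λ j → shift (suc j) (toppedMaexGF j) n) ⟨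
  Σ< (suc N) (λ j → shift (suc j) (toppedMaexGF j) n)          ∎

toppedMaexGF-suc : ∀ N n → toppedMaexGF (suc N) n ≡ shift (suc N) (toppedMaexGF N) n + suc N * subsetGF N n
toppedMaexGF-suc N n = begin
  toppedMaexGF (suc N) n
    ≡⟨ gf-subsets-suc N _ n ⟩
  shift (suc N) (gf (subsets N) (λ π → maex (suc (suc N) ∷ suc N ∷ π))) n + gf (subsets N) (λ π → maex (suc (suc N) ∷ π)) n
    ≡⟨ cong₂ _+_ (shift-cong (suc N) (λ m → gf-cong _ _ m (largest-subsets N) maex-∷-∷) n)
                 (gf-cong _ _ n (largest-subsets N) maex-∷-gap) ⟩
  shift (suc N) (toppedMaexGF N) n + gf (subsets N) (λ _ → suc N) n
    ≡⟨ cong (shift (suc N) (toppedMaexGF N) n +_) (gf-const (subsets N) (suc N) n) ⟩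
  shift (suc N) (toppedMaexGF N) n + suc N * subsetGF N n
    ∎

blockSum : ℕ → ℕ → ℕ
blockSum s zero    = 0
blockSum s (suc d) = s + d + blockSum s d

blockSum-suc : ∀ k d → blockSum (suc k) d ≡ triangle d + k * d
blockSum-suc k zero    = sym (*-zeroʳ k)
blockSum-suc k (suc d) = trans (cong (suc k + d +_) (blockSum-suc k d)) (arith k d (triangle d))
  where
    arith : ∀ k d t → suc k + d + (t + k * d) ≡ t + suc d + k * suc d
    arith = solve-∀

blockSum-extend : ∀ {i N} → i < N → suc N + blockSum (2 + i) (N ∸ suc i) ≡ blockSum (2 + i) (N ∸ i)
blockSum-extend {i} {N} i<N = begin
  suc N + blockSum (2 + i) (N ∸ suc i)                     ≡⟨ cong (λ k → suc k + blockSum (2 + i) (N ∸ suc i)) (m+[n∸m]≡n i<N) ⟨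
  suc (suc i + (N ∸ suc i)) + blockSum (2 + i) (N ∸ suc i)  ≡⟨ cong (blockSum (2 + i)) (+-∸-assoc 1 i<N) ⟨
  blockSum (2 + i) (N ∸ i)                                 ∎

toppedMaexGF-closed : ∀ N n → toppedMaexGF N n ≡ Σ< N (λ i → suc i * shift (blockSum (2 + i) (N ∸ suc i)) (subsetGF i) n)
toppedMaexGF-closed zero    zero    = refl
toppedMaexGF-closed zero    (suc n) = refl
toppedMaexGF-closed (suc N) n       = begin
  toppedMaexGF (suc N) n
    ≡⟨ toppedMaexGF-suc N n ⟩
  shift (suc N) (toppedMaexGF N) n + suc N * subsetGF N n
    ≡⟨ cong (_+ suc N * subsetGF N n) (shift-cong (suc N) (toppedMaexGF-closed N) n) ⟩
  shift (suc N) (λ m → Σ< N (λ i → term N i m)) n + suc N * subsetGF N n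
    ≡⟨ cong (_+ suc N * subsetGF N n) (shift-Σ< (suc N) N (term N) n) ⟩
  Σ< N (λ i → shift (suc N) (term N i) n) + suc N * subsetGF N n
    ≡⟨ cong₂ _+_ (Σ<-cong N raise) (cong (λ d → suc N * shift (blockSum (2 + N) d) (subsetGF N) n) (n∸n≡0 N)) ⟨
  Σ< N (λ i → term (suc N) i n) + term (suc N) N n
    ≡⟨ Σ<-suc N (λ i → term (suc N) i n) ⟨
  Σ< (suc N) (λ i → term (suc N) i n)
    ∎
  where
    term : ℕ → ℕ → Series
    term j i m = suc i * shift (blockSum (2 + i) (j ∸ suc i)) (subsetGF i) m
    raise : ∀ {i} → i < N → term (suc N) i n ≡ shift (suc N) (term N i) n
    raise {i} i<N = begin
      suc i * shift (blockSum (2 + i) (N ∸ i)) (subsetGF i) n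
        ≡⟨ cong (λ e → suc i * shift e (subsetGF i) n) (blockSum-extend i<N) ⟨
      suc i * shift (suc N + blockSum (2 + i) (N ∸ suc i)) (subsetGF i) n
        ≡⟨ cong (suc i *_) (shift-shift (suc N) _ (subsetGF i) n) ⟨
      suc i * shift (suc N) (shift (blockSum (2 + i) (N ∸ suc i)) (subsetGF i)) n
        ≡⟨ shift-*ˡ (suc N) (suc i) _ n ⟨
      shift (suc N) (term N i) n
        ∎

maexGF-closed : ∀ N n → maexGF N n ≡
                Σ< N (λ i → suc i * Σ< (N ∸ suc i) (λ m → shift (triangle (suc m) + suc i * suc m) (negqPoch i) n))
maexGF-closed N n = begin
  maexGF N n
    ≡⟨ maexGF-unrolled N n ⟩
  Σ< N (λ j → shift (suc j) (toppedMaexGF j) n)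
    ≡⟨ Σ<-cong N (λ {j} _ → trans (shift-cong (suc j) (toppedMaexGF-closed j) n) (shift-Σ< (suc j) j (term j) n)) ⟩
  Σ< N (λ j → Σ< j (λ i → shift (suc j) (term j i) n))
    ≡⟨ Σ<-triangle N (λ i j → shift (suc j) (term j i) n) ⟩
  Σ< N (λ i → Σ< (N ∸ suc i) (λ m → shift (suc (suc i + m)) (term (suc i + m) i) n))
    ≡⟨ Σ<-cong N (λ {i} _ → trans (Σ<-cong (N ∸ suc i) (λ {m} _ → entry i m)) (sym (sum-map-*ˡ (suc i) _ (upTo (N ∸ suc i))))) ⟩
  Σ< N (λ i → suc i * Σ< (N ∸ suc i) (λ m → shift (triangle (suc m) + suc i * suc m) (negqPoch i) n))
    ∎
  where
    term : ℕ → ℕ → Series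
    term j i m = suc i * shift (blockSum (2 + i) (j ∸ suc i)) (subsetGF i) m
    entry : ∀ i m → shift (suc (suc i + m)) (term (suc i + m) i) n ≡ suc i * shift (triangle (suc m) + suc i * suc m) (negqPoch i) n
    entry i m = begin
      shift (suc (suc i + m)) (term (suc i + m) i) n
        ≡⟨ shift-*ˡ (suc (suc i + m)) (suc i) _ n ⟩
      suc i * shift (suc (suc i + m)) (shift (blockSum (2 + i) (suc i + m ∸ suc i)) (subsetGF i)) n
        ≡⟨ cong (suc i *_) (shift-shift (suc (suc i + m)) _ (subsetGF i) n) ⟩
      suc i * shift (suc (suc i + m) + blockSum (2 + i) (suc i + m ∸ suc i)) (subsetGF i) n
        ≡⟨ cong (λ d → suc i * shift (suc (suc i + m) + blockSum (2 + i) d) (subsetGF i) n) (m+n∸m≡n (suc i) m) ⟩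
      suc i * shift (blockSum (2 + i) (suc m)) (subsetGF i) n
        ≡⟨ cong (λ e → suc i * shift e (subsetGF i) n) (blockSum-suc (suc i) (suc m)) ⟩
      suc i * shift (triangle (suc m) + suc i * suc m) (subsetGF i) n
        ≡⟨ cong (suc i *_) (shift-cong (triangle (suc m) + suc i * suc m) (subsetGF≡negqPoch i) n) ⟩
      suc i * shift (triangle (suc m) + suc i * suc m) (negqPoch i) n
        ∎

theorem2p7 : (n : ℕ) → σdmaex n ≡ rhs n
theorem2p7 n = begin
  σdmaex n
    ≡⟨ sum-map-filter maex n (subsets n) ⟩
  maexGF n n
    ≡⟨ maexGF-closed n n ⟩
  Σ< n (λ i → suc i * Σ< (n ∸ suc i) (λ m → shift (exponent i (suc m)) (negqPoch i) n))
    ≡⟨ Σ<-cong n (λ {i} _ → cong (suc i *_) (Σ<-extend _ (m∸n≤m n (suc i)) (shift-> (negqPoch i) ∘ beyond i))) ⟩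
  Σ< n (λ i → suc i * Σ< n (λ m → shift (exponent i (suc m)) (negqPoch i) n))
    ≡⟨ Σ<-cong n (λ {i} _ → cong (suc i *_) (⊗-Σ≥1-qpow (negqPoch i) (exponent i) (m≤exponent i) n)) ⟨
  rhs n
    ∎
  where
    exponent : ℕ → ℕ → ℕ
    exponent i m = triangle m + suc i * m
    m≤exponent : ∀ i m → m ≤ exponent i m
    m≤exponent i m = ≤-trans (m≤n*m m (suc i)) (m≤n+m (suc i * m) (triangle m))
    beyond : ∀ i {m} → n ∸ suc i ≤ m → n < exponent i (suc m)
    beyond i {m} n∸1+i≤m =
      <-≤-trans (s≤s n≤m+1+i) (+-mono-≤ (m≤n+m (suc m) (triangle m)) (m≤m*n (suc i) (suc m)))
      where
        n≤m+1+i : n ≤ m + suc i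
        n≤m+1+i = ≤-trans (m≤n+m∸n n (suc i)) (≤-trans (+-monoʳ-≤ (suc i) n∸1+i≤m) (≤-reflexive (+-comm (suc i) m)))
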